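{- The map $\mathsf{MoToNe}$ defined below, from Motzkin trees to neutral $\lambda$-terms, is a bijection.
   Context: $\lambda$-terms in de Bruijn notation are generated by $T ::= \underline{\mathsf{n}} \mid \lambda T \mid T\,T$, where indices are generated by $\underline{\mathsf{0}}$ and $S\,\underline{\mathsf{n}}$. Normal forms $\mathcal N$ and neutral terms $\mathcal M$ are defined by $\mathcal N = \mathcal M \mid \lambda\,\mathcal N$ and $\mathcal M = \mathcal M\,\mathcal N \mid \underline{\mathsf{n}}$ (a neutral term is an index or an application of a neutral term to a normal form). Motzkin trees are plane rooted trees in which each node has $0$, $1$ (unary) or $2$ (binary, ordered left/right) children. For $n\ge1$, a unary path $u_n$ is a chain of $n$ nodes, each with one child except the last, which is a leaf. Define $\mathsf{MoToNe}$: (1) if the tree is a unary path $u_n$, it maps to the index $S^{n-1}\underline{\mathsf{0}}$; (2) if the tree consists of a chain of $n\ge1$ unary nodes on top of a binary node with left subtree $t$ and right subtree $t'$, it maps to $\mathsf{MoToNe}(t)\,(\lambda^n\,\mathsf{MoToNe}(t'))$; (3) if the root is binary with left subtree $t$ and right subtree $t'$, it maps to $\mathsf{MoToNe}(t)\,\mathsf{MoToNe}(t')$. -}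

module Defs where

open import Data.Nat using (ℕ; zero; suc)
open import Data.Product using (Σ; _,_; proj₁)

-- de Bruijn λ-terms: T ::= n | λ T | T T ; index n stands for S^n 0
data Term : Set where
  var : ℕ → Term
  lam : Term → Term
  app : Term → Term → Term

mutual
  data Normal : Term → Set where
    ne  : ∀ {t} → Neutral t → Normal t
    lam : ∀ {t} → Normal t → Normal (lam t)

  data Neutral : Term → Set where
    var : ∀ n → Neutral (var n)
    app : ∀ {m t} → Neutral m → Normal t → Neutral (app m t)

NeutralTerm : Set
NeutralTerm = Σ Term Neutral

data Motzkin : Set where
  leaf  : Motzkin
  unary : Motzkin → Motzkin
  binary : Motzkin → Motzkin → Motzkin

lams : ℕ → Term → Term
lams zero t = t
lams (suc n) t = lam (lams n t)

lams-normal : ∀ n {t} → Normal t → Normal (lams n t)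
lams-normal zero p = p
lams-normal (suc n) p = lam (lams-normal n p)

-- MoToNe.  `go k t` handles the tree consisting of k unary nodes on top of t
-- (k already-consumed unary nodes).
mutual
  moToNe : Motzkin → NeutralTerm
  moToNe t = go zero t

  go : ℕ → Motzkin → NeutralTerm
  -- (1) unary path u_{k+1} (k unary nodes then a leaf) ↦ S^k 0
  go k leaf = var k , var k
  go k (unary t) = go (suc k) t
  -- (3) binary root: MoToNe t · MoToNe t'
  go zero (binary t t') with moToNe t | moToNe t'
  ... | m , pm | n , pn = app m n , app pm (ne pn)
  -- (2) n ≥ 1 unary nodes over binary node: MoToNe t · (λ^n MoToNe t')
  go (suc k) (binary t t') with moToNe t | moToNe t'
  ... | m , pm | n , pn = app m (lams (suc k) n) , app pm (lams-normal (suc k) (ne pn))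

-- A neutral term is a head variable applied to a spine of normal forms, and
-- a normal form is λ^k of a neutral term.  Reading a Motzkin tree from the
-- root, a unary path u_{n+1} is the variable n, and a binary node under k
-- unary nodes is an application whose argument starts with exactly k
-- lambdas.  The inverse therefore strips the lambdas of the argument of an
-- application and turns them back into unary nodes; both composites are
-- identities by induction, the accumulator k of `go` playing the role of the
-- stripped lambdas.
module Submission where

open import Defs
open import Data.Nat using (ℕ; zero; suc; _+_)
open import Data.Nat.Properties using (+-suc; +-identityʳ)
open import Data.Product using (_,_; proj₁; proj₂)
open import Function using (_∘_)
open import Function.Bundles using (Bijection; mk↔ₛ′)
open import Function.Properties.Inverse using (↔⇒⤖)
open import Function.Definitions using (Bijective)
open import Relation.Binary.PropositionalEquality
  using (_≡_; refl; sym; trans; cong; cong₂; module ≡-Reasoning)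
open ≡-Reasoning

mutual
  Neutral-irrelevant : ∀ {t} (p q : Neutral t) → p ≡ q
  Neutral-irrelevant (var n) (var .n) = refl
  Neutral-irrelevant (app p p′) (app q q′) =
    cong₂ app (Neutral-irrelevant p q) (Normal-irrelevant p′ q′)

  Normal-irrelevant : ∀ {t} (p q : Normal t) → p ≡ q
  Normal-irrelevant (ne p)  (ne q)  = cong ne (Neutral-irrelevant p q)
  Normal-irrelevant (lam p) (lam q) = cong lam (Normal-irrelevant p q)

NeutralTerm-≡ : ∀ {x y : NeutralTerm} → proj₁ x ≡ proj₁ y → x ≡ y
NeutralTerm-≡ {t , p} {.t , q} refl = cong (t ,_) (Neutral-irrelevant p q)

lams-lam : ∀ k t → lams k (lam t) ≡ lams (suc k) t
lams-lam zero    t = refl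
lams-lam (suc k) t = cong lam (lams-lam k t)

-- The k unary nodes are added at the bottom of the chain, as `go` consumes them.
unaries : ℕ → Motzkin → Motzkin
unaries zero    t = t
unaries (suc k) t = unaries k (unary t)

go-unaries : ∀ j k t → go j (unaries k t) ≡ go (j + k) t
go-unaries j zero    t = cong (λ i → go i t) (sym (+-identityʳ j))
go-unaries j (suc k) t =
  trans (go-unaries j k (unary t)) (cong (λ i → go i t) (sym (+-suc j k)))

-- Cases (2) and (3) of MoToNe at once, since λ^0 N = N.
app-lams : ℕ → NeutralTerm → NeutralTerm → NeutralTerm
app-lams k (m , pm) (n , pn) = app m (lams k n) , app pm (lams-normal k (ne pn))

go-binary : ∀ k t t′ → go k (binary t t′) ≡ app-lams k (moToNe t) (moToNe t′)
go-binary zero t t′ with moToNe t | moToNe t′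
... | _ , _ | _ , _ = refl
go-binary (suc k) t t′ with moToNe t | moToNe t′
... | _ , _ | _ , _ = refl

-- In `fromApp k l q` the tree l is the head and k counts the lambdas already
-- stripped from the argument q.
mutual
  fromNeutral : ∀ {t} → Neutral t → Motzkin
  fromNeutral (var n)   = unaries n leaf
  fromNeutral (app p q) = fromApp zero (fromNeutral p) q

  fromApp : ∀ {t} → ℕ → Motzkin → Normal t → Motzkin
  fromApp k l (lam q) = fromApp (suc k) l q
  fromApp k l (ne q)  = unaries k (binary l (fromNeutral q))

fromNeutralTerm : NeutralTerm → Motzkin
fromNeutralTerm = fromNeutral ∘ proj₂

fromApp-lams : ∀ {t} j k l (p : Normal t) →
               fromApp j l (lams-normal k p) ≡ fromApp (j + k) l p
fromApp-lams j zero    l p = cong (λ i → fromApp i l p) (sym (+-identityʳ j))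
fromApp-lams j (suc k) l p =
  trans (fromApp-lams (suc j) k l p) (cong (λ i → fromApp i l p) (sym (+-suc j k)))

fromNeutral-go : ∀ k t → fromNeutralTerm (go k t) ≡ unaries k t
fromNeutral-go k leaf       = refl
fromNeutral-go k (unary t)  = fromNeutral-go (suc k) t
fromNeutral-go k (binary t t′) = begin
  fromNeutralTerm (go k (binary t t′))
    ≡⟨ cong fromNeutralTerm (go-binary k t t′) ⟩
  fromApp 0 (fromNeutralTerm (moToNe t)) (lams-normal k (ne (proj₂ (moToNe t′))))
    ≡⟨ fromApp-lams 0 k _ _ ⟩
  unaries k (binary (fromNeutralTerm (moToNe t)) (fromNeutralTerm (moToNe t′)))
    ≡⟨ cong₂ (λ l r → unaries k (binary l r)) (fromNeutral-go 0 t) (fromNeutral-go 0 t′) ⟩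
  unaries k (binary t t′) ∎

mutual
  term-moToNe-fromNeutral : ∀ {t} (p : Neutral t) → proj₁ (moToNe (fromNeutral p)) ≡ t
  term-moToNe-fromNeutral (var n) = cong proj₁ (go-unaries 0 n leaf)
  term-moToNe-fromNeutral (app p q) =
    term-moToNe-fromApp 0 q (fromNeutral p) (term-moToNe-fromNeutral p)

  term-moToNe-fromApp : ∀ {s m} k (q : Normal s) l → proj₁ (moToNe l) ≡ m →
                        proj₁ (moToNe (fromApp k l q)) ≡ app m (lams k s)
  term-moToNe-fromApp {lam s} k (lam q) l e =
    trans (term-moToNe-fromApp (suc k) q l e) (cong (app _) (sym (lams-lam k s)))
  term-moToNe-fromApp {s} {m} k (ne q) l e = begin
    proj₁ (go 0 (unaries k (binary l (fromNeutral q))))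
      ≡⟨ cong proj₁ (go-unaries 0 k _) ⟩
    proj₁ (go k (binary l (fromNeutral q)))
      ≡⟨ cong proj₁ (go-binary k l _) ⟩
    app (proj₁ (moToNe l)) (lams k (proj₁ (moToNe (fromNeutral q))))
      ≡⟨ cong₂ (λ a b → app a (lams k b)) e (term-moToNe-fromNeutral q) ⟩
    app m (lams k s) ∎

moToNe-fromNeutralTerm : ∀ x → moToNe (fromNeutralTerm x) ≡ x
moToNe-fromNeutralTerm (_ , p) = NeutralTerm-≡ (term-moToNe-fromNeutral p)

fromNeutralTerm-moToNe : ∀ t → fromNeutralTerm (moToNe t) ≡ t
fromNeutralTerm-moToNe = fromNeutral-go 0

mainTheorem7 : Bijective {A = Motzkin} {B = NeutralTerm} _≡_ _≡_ moToNe
mainTheorem7 = Bijection.bijective (↔⇒⤖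
  (mk↔ₛ′ moToNe fromNeutralTerm moToNe-fromNeutralTerm fromNeutralTerm-moToNe))
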